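{- Let $\Gamma=(V,E)$ be a finite graph and let $\alpha:E\to\mathbb{R}^n\setminus\{0\}$ satisfy $\alpha(e^{ -1})=-\alpha(e)$ for all oriented edges $e$, and suppose $\alpha$ is $3$-independent. If $\nabla$ and $\nabla'$ are two connections on $\Gamma$ such that $\alpha$ is an axial function compatible with $\nabla$ and also an axial function compatible with $\nabla'$, then $\nabla=\nabla'$.
   Context: Each edge of $\Gamma$ is counted twice, once with each orientation; for an oriented edge $e=(x,y)$ write $\iota(e)=x$, $\tau(e)=y$, $e^{ -1}=(y,x)$. The star of a vertex $x$ is $\mathrm{star}(x)=\{e:\iota(e)=x\}$. A connection $\nabla$ on $\Gamma$ assigns to each oriented edge $e=(x,y)$ a map $\nabla_{(x,y)}:\mathrm{star}(x)\to\mathrm{star}(y)$ such that $\nabla_{(x,y)}(x,y)=(y,x)$ and $\nabla_{(y,x)}=(\nabla_{(x,y)})^{ -1}$. An edge chain for $\nabla$ is a triple of oriented edges $(d,e,f)=((x,y),(y,z),(z,w))$ with $\nabla_{(y,z)}(y,x)=(z,w)$. A map $\alpha:E\to\mathbb{R}^n\setminus\{0\}$ with $\alpha(e^{ -1})=-\alpha(e)$ is an axial function compatible with $\nabla$ if for every edge chain $(d,e,f)$ of $\nabla$ the vectors $\alpha(d),\alpha(e),\alpha(f)$ are coplanar (span a subspace of dimension at most $2$). $\alpha$ is $3$-independent if for every vertex $p$ any three of the vectors $\alpha(e)$, $e\in\mathrm{star}(p)$, are linearly independent. -}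

module Defs where

open import Level using (Level; _⊔_; suc)
open import Data.Nat using (ℕ)
open import Data.Fin using (Fin)
open import Data.Bool using (Bool; true; false)
open import Data.Product using (Σ; ∃; ∃-syntax; _×_; _,_)
open import Data.Sum using (_⊎_)
open import Relation.Nullary using (¬_)
open import Relation.Binary.PropositionalEquality using (_≡_)
open import Algebra.Bundles using (CommutativeRing)

-- Fields (the stdlib has no Field bundle): a commutative ring with
-- 0 ≠ 1 in which every nonzero element has a multiplicative inverse.
-- ℝ is an instance; the paper's statement is the case K = ℝ.

record Field (c ℓ : Level) : Set (suc (c ⊔ ℓ)) where
  field
    commutativeRing : CommutativeRing c ℓ
  open CommutativeRing commutativeRing public
  field
    0≉1     : ¬ (0# ≈ 1#)
    inverse : ∀ x → ¬ (x ≈ 0#) → ∃[ y ] (x * y ≈ 1#)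

-- Finite simple graphs on vertex set Fin N.
-- Oriented edges are the pairs (x , y) with Edge x y; both orientations
-- of each edge are present by symmetry.

record Graph : Set where
  field
    N       : ℕ
    adj     : Fin N → Fin N → Bool
    symm    : ∀ x y → adj x y ≡ adj y x
    irrefl  : ∀ x → adj x x ≡ false

  V : Set
  V = Fin N

  Edge : V → V → Set
  Edge x y = adj x y ≡ true

-- An oriented edge of star(x) is (x , z) with Edge x z, so
-- it is determined by its terminal vertex z; we therefore encode
-- ∇_(x,y) : star(x) → star(y) by a function on vertices, sending the
-- terminal vertex z of (x,z) to the terminal vertex of ∇_(x,y)(x,z).

module _ (Γ : Graph) where
  open Graph Γ

  record Connection : Set where
    field
      ∇ : V → V → V → V
      ∇-star  : ∀ {x y z} → Edge x y → Edge x z → Edge y (∇ x y z)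
      ∇-back  : ∀ {x y} → Edge x y → ∇ x y y ≡ x
      -- ∇_(y,x) = (∇_(x,y))⁻¹  (both composites are the identity on the
      -- respective stars, by applying this to (x,y) and to (y,x))
      ∇-inv   : ∀ {x y z} → Edge x y → Edge x z → ∇ y x (∇ x y z) ≡ z

  SameConnection : Connection → Connection → Set
  SameConnection C C' =
    ∀ {x y z} → Edge x y → Edge x z →
      Connection.∇ C x y z ≡ Connection.∇ C' x y z

module LinAlg {c ℓ : Level} (K : Field c ℓ) (n : ℕ) where
  open Field K

  Vect : Set c
  Vect = Fin n → Carrier

  _≈ᵛ_ : Vect → Vect → Set ℓ
  u ≈ᵛ v = ∀ i → u i ≈ v i

  0ᵛ : Vect
  0ᵛ i = 0#

  -ᵛ_ : Vect → Vect
  (-ᵛ u) i = - (u i)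

  lin3 : Carrier → Carrier → Carrier → Vect → Vect → Vect → Vect
  lin3 a b d u v w i = a * u i + b * v i + d * w i

  LinIndep3 : Vect → Vect → Vect → Set (c ⊔ ℓ)
  LinIndep3 u v w = ∀ a b d → lin3 a b d u v w ≈ᵛ 0ᵛ →
    (a ≈ 0#) × (b ≈ 0#) × (d ≈ 0#)

  -- u, v, w coplanar: span a subspace of dimension ≤ 2, i.e. they are
  -- linearly dependent (a nontrivial relation a u + b v + c w = 0).
  Coplanar : Vect → Vect → Vect → Set (c ⊔ ℓ)
  Coplanar u v w = ∃[ a ] ∃[ b ] ∃[ d ]
    ((¬ (a ≈ 0#) ⊎ ¬ (b ≈ 0#) ⊎ ¬ (d ≈ 0#)) × lin3 a b d u v w ≈ᵛ 0ᵛ)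

module _ {c ℓ : Level} (K : Field c ℓ) (n : ℕ) (Γ : Graph) where
  open Field K
  open LinAlg K n
  open Graph Γ

  -- α : E → K^n ∖ {0} with α(e⁻¹) = -α(e); α is given on all pairs but
  -- only its values on oriented edges matter.
  record EdgeLabel : Set (c ⊔ ℓ) where
    field
      α : V → V → Vect
      α-nonzero : ∀ {x y} → Edge x y → ¬ (α x y ≈ᵛ 0ᵛ)
      α-antisym : ∀ {x y} → Edge x y → α y x ≈ᵛ (-ᵛ α x y)

  ThreeIndependent : EdgeLabel → Set (c ⊔ ℓ)
  ThreeIndependent A = ∀ {p x y z} → Edge p x → Edge p y → Edge p z →
    ¬ (x ≡ y) → ¬ (x ≡ z) → ¬ (y ≡ z) →
    LinIndep3 (EdgeLabel.α A p x) (EdgeLabel.α A p y) (EdgeLabel.α A p z)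

  CompatibleWith : EdgeLabel → Connection Γ → Set (c ⊔ ℓ)
  CompatibleWith A C = ∀ {x y z w} → Edge x y → Edge y z →
    Connection.∇ C y z x ≡ w →
    Coplanar (EdgeLabel.α A x y) (EdgeLabel.α A y z) (EdgeLabel.α A z w)

-- Fix an edge (x,y) and z ∈ star(x) with z ≠ y, and let w, w' be the
-- terminal vertices of ∇_(x,y)(x,z) and ∇'_(x,y)(x,z).  The edge chains
-- ((z,x),(x,y),(y,w)) and ((z,x),(x,y),(y,w')) put α(y,w) and α(y,w') in
-- the plane spanned by α(x,z) and α(x,y), which 3-independence at x makes
-- a genuine plane.  Since α(y,x) = -α(x,y) lies there too, w ≠ w' would
-- give three independent vectors of star(y) inside a plane.

module Submission where

open import Defs
open import Level using (Level; _⊔_)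
open import Data.Nat using (ℕ)
open import Data.Fin using (_≟_)
open import Data.Maybe using (nothing)
open import Data.Product using (_×_; _,_; proj₁; proj₂)
open import Data.Sum using (_⊎_; inj₁; inj₂)
open import Data.Empty using (⊥-elim)
open import Relation.Nullary using (¬_; yes; no)
import Relation.Binary.PropositionalEquality as ≡
open ≡ using (_≡_)

module FieldProperties {c ℓ : Level} (K : Field c ℓ) where
  open Field K
  open import Algebra.Properties.Ring ring using (-0#≈0#; -‿injective)
  open import Relation.Binary.Reasoning.Setoid setoid

  x*y≈0⇒x≈0 : ∀ {x y} → ¬ y ≈ 0# → x * y ≈ 0# → x ≈ 0#
  x*y≈0⇒x≈0 {x} {y} y≉0 xy≈0 with inverse y y≉0
  ... | y⁻¹ , yy⁻¹≈1 = begin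
    x             ≈⟨ *-identityʳ x ⟨
    x * 1#        ≈⟨ *-congˡ yy⁻¹≈1 ⟨
    x * (y * y⁻¹) ≈⟨ *-assoc x y y⁻¹ ⟨
    x * y * y⁻¹   ≈⟨ *-congʳ xy≈0 ⟩
    0# * y⁻¹      ≈⟨ zeroˡ y⁻¹ ⟩
    0#            ∎

  -x≈0⇒x≈0 : ∀ {x} → - x ≈ 0# → x ≈ 0#
  -x≈0⇒x≈0 -x≈0 = -‿injective (trans -x≈0 (sym -0#≈0#))

  *-≈0ʳ : ∀ x {y} → y ≈ 0# → x * y ≈ 0#
  *-≈0ʳ x y≈0 = trans (*-congˡ y≈0) (zeroʳ x)

  *-≈0ˡ : ∀ {x} y → x ≈ 0# → x * y ≈ 0#
  *-≈0ˡ y x≈0 = trans (*-congʳ x≈0) (zeroˡ y)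

  +-≈0 : ∀ {x y} → x ≈ 0# → y ≈ 0# → x + y ≈ 0#
  +-≈0 x≈0 y≈0 = trans (+-cong x≈0 y≈0) (+-identityʳ 0#)

  x≈-y⇒x+y≈0 : ∀ {x y} → x ≈ - y → x + y ≈ 0#
  x≈-y⇒x+y≈0 {y = y} x≈-y = trans (+-congʳ x≈-y) (-‿inverseˡ y)

  x+y≈z⇒x≈0 : ∀ {x y z} → x + y ≈ z → y ≈ 0# → z ≈ 0# → x ≈ 0#
  x+y≈z⇒x≈0 {x} {y} {z} x+y≈z y≈0 z≈0 = begin
    x      ≈⟨ +-identityʳ x ⟨
    x + 0# ≈⟨ +-congˡ y≈0 ⟨
    x + y  ≈⟨ x+y≈z ⟩
    z      ≈⟨ z≈0 ⟩
    0#     ∎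

module PlaneLemmas {c ℓ : Level} (K : Field c ℓ) (n : ℕ) where
  open Field K
  open LinAlg K n
  open FieldProperties K
  open import Algebra.Properties.Ring ring using (-‿distribˡ-*; -‿distribʳ-*)
  open import Algebra.Solver.Ring.NaturalCoefficients commutativeSemiring (λ _ _ → nothing)

  LinIndep2 : Vect → Vect → Set (c ⊔ ℓ)
  LinIndep2 u v = ∀ a b → (∀ i → a * u i + b * v i ≈ 0#) → (a ≈ 0#) × (b ≈ 0#)

  linIndep3⇒linIndep2 : ∀ {u v w} → LinIndep3 u v w → LinIndep2 u v
  linIndep3⇒linIndep2 {u} {v} {w} indep a b au+bv≈0 =
    let a≈0 , b≈0 , _ = indep a b 0# (λ i → +-≈0 (au+bv≈0 i) (zeroˡ (w i)))
    in a≈0 , b≈0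

  linIndep2-negˡ : ∀ {v u s} → LinIndep2 v u → s ≈ᵛ (-ᵛ v) → LinIndep2 s u
  linIndep2-negˡ {v} {u} {s} indep s≈-v a b as+bu≈0 =
    let -a≈0 , b≈0 = indep (- a) b (λ i → trans (+-congʳ (-av≈as i)) (as+bu≈0 i))
    in -x≈0⇒x≈0 -a≈0 , b≈0
    where
    -av≈as : ∀ i → - a * v i ≈ a * s i
    -av≈as i = trans (sym (-‿distribˡ-* a (v i)))
                     (trans (-‿distribʳ-* a (v i)) (*-congˡ (sym (s≈-v i))))

  coplanar-third-coefficient≉0 : ∀ {s u p a b d} → LinIndep2 s u →
    (¬ (a ≈ 0#) ⊎ ¬ (b ≈ 0#) ⊎ ¬ (d ≈ 0#)) → lin3 a b d s u p ≈ᵛ 0ᵛ → ¬ (d ≈ 0#)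
  coplanar-third-coefficient≉0 {p = p} indep nontrivial relation d≈0
    with indep _ _ (λ i → x+y≈z⇒x≈0 (relation i) (*-≈0ˡ (p i) d≈0) refl) | nontrivial
  ... | a≈0 , _   | inj₁ a≉0        = a≉0 a≈0
  ... | _ , b≈0   | inj₂ (inj₁ b≉0) = b≉0 b≈0
  ... | _         | inj₂ (inj₂ d≉0) = d≉0 d≈0

  -- ā and b̄ stand for - a and - b, which makes this an identity of commutative semirings.
  elimination-identity : ∀ a ā b b̄ d a' b' d' s u p p' q →
    (a * b' + a' * b̄) * q + a' * d * p + ā * d' * p'
      + (a' * s * (a + ā) + b' * u * (a + ā) + a' * b * (q + u))
    ≈ a' * (a * s + b * u + d * p) + ā * (a' * s + b' * u + d' * p')
      + a * b' * (q + u) + a' * q * (b + b̄)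
  elimination-identity = solve 13 (λ a ā b b̄ d a' b' d' s u p p' q →
    (a :* b' :+ a' :* b̄) :* q :+ a' :* d :* p :+ ā :* d' :* p'
      :+ (a' :* s :* (a :+ ā) :+ b' :* u :* (a :+ ā) :+ a' :* b :* (q :+ u))
    := a' :* (a :* s :+ b :* u :+ d :* p) :+ ā :* (a' :* s :+ b' :* u :+ d' :* p')
      :+ a :* b' :* (q :+ u) :+ a' :* q :* (b :+ b̄)) refl

  reduction-identity : ∀ a b b̄ d s u p q →
    b̄ * q + d * p + (s * a + b * (q + u)) ≈ a * s + b * u + d * p + q * (b + b̄)
  reduction-identity = solve 8 (λ a b b̄ d s u p q →
    b̄ :* q :+ d :* p :+ (s :* a :+ b :* (q :+ u)) := a :* s :+ b :* u :+ d :* p :+ q :* (b :+ b̄)) refl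

  module _ {s u q p p' : Vect} (q≈-u : q ≈ᵛ (-ᵛ u)) (indep : LinIndep3 q p p') where

    q+u≈0 : ∀ i → q i + u i ≈ 0#
    q+u≈0 i = x≈-y⇒x+y≈0 (q≈-u i)

    first-coefficient≈0 : ∀ {a b d a' b' d'} → ¬ (d' ≈ 0#) →
      lin3 a b d s u p ≈ᵛ 0ᵛ → lin3 a' b' d' s u p' ≈ᵛ 0ᵛ → a ≈ 0#
    first-coefficient≈0 {a} {b} {d} {a'} {b'} {d'} d'≉0 X Y =
      -x≈0⇒x≈0 (x*y≈0⇒x≈0 d'≉0 (proj₂ (proj₂ (indep _ _ _ relation))))
      where
      -- a' (a s + b u + d p) - a (a' s + b' u + d' p'), rewritten with u = - q
      relation : lin3 (a * b' + a' * - b) (a' * d) (- a * d') q p p' ≈ᵛ 0ᵛ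
      relation i = x+y≈z⇒x≈0
        (elimination-identity a (- a) b (- b) d a' b' d' (s i) (u i) (p i) (p' i) (q i))
        (+-≈0 (+-≈0 (*-≈0ʳ _ (-‿inverseʳ a)) (*-≈0ʳ _ (-‿inverseʳ a))) (*-≈0ʳ _ (q+u≈0 i)))
        (+-≈0 (+-≈0 (+-≈0 (*-≈0ʳ a' (X i)) (*-≈0ʳ (- a) (Y i))) (*-≈0ʳ _ (q+u≈0 i)))
              (*-≈0ʳ _ (-‿inverseʳ b)))

    third-coefficient≈0 : ∀ {a b d} → a ≈ 0# → lin3 a b d s u p ≈ᵛ 0ᵛ → d ≈ 0#
    third-coefficient≈0 {a} {b} {d} a≈0 X = proj₁ (proj₂ (indep (- b) d 0# relation))
      where
      relation : lin3 (- b) d 0# q p p' ≈ᵛ 0ᵛ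
      relation i = +-≈0
        (x+y≈z⇒x≈0 (reduction-identity a b (- b) d (s i) (u i) (p i) (q i))
          (+-≈0 (*-≈0ʳ (s i) a≈0) (*-≈0ʳ b (q+u≈0 i)))
          (+-≈0 (X i) (*-≈0ʳ (q i) (-‿inverseʳ b))))
        (zeroˡ (p' i))

  coplanar₂⇒¬linIndep3 : ∀ {s u q p p'} → LinIndep2 s u → q ≈ᵛ (-ᵛ u) →
    Coplanar s u p → Coplanar s u p' → ¬ LinIndep3 q p p'
  coplanar₂⇒¬linIndep3 indep q≈-u (a , _ , _ , nt , X) (_ , _ , _ , nt' , Y) indep₃ =
    coplanar-third-coefficient≉0 indep nt X (third-coefficient≈0 q≈-u indep₃ a≈0 X)
    where
    a≈0 : a ≈ 0#
    a≈0 = first-coefficient≈0 q≈-u indep₃ (coplanar-third-coefficient≉0 indep nt' Y) X Y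

module ConnectionProperties (Γ : Graph) where
  open Graph Γ

  edge-sym : ∀ {x y} → Edge x y → Edge y x
  edge-sym {x} {y} = ≡.trans (symm y x)

  module _ (C : Connection Γ) where
    open Connection C

    ∇-injective : ∀ {x y z z'} → Edge x y → Edge x z → Edge x z' →
      ∇ x y z ≡ ∇ x y z' → z ≡ z'
    ∇-injective {x} {y} exy exz exz' eq =
      ≡.trans (≡.sym (∇-inv exy exz)) (≡.trans (≡.cong (∇ y x) eq) (∇-inv exy exz'))

    ∇-avoids-back : ∀ {x y z} → Edge x y → Edge x z → ¬ (z ≡ y) → ¬ (x ≡ ∇ x y z)
    ∇-avoids-back exy exz z≢y x≡∇z =
      z≢y (∇-injective exy exz exy (≡.trans (≡.sym x≡∇z) (≡.sym (∇-back exy))))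

open Connection using (∇; ∇-star; ∇-back; ∇-inv)

mainTheorem2 : {c ℓ : Level} (K : Field c ℓ) (n : ℕ) (Γ : Graph)
    (A : EdgeLabel K n Γ) → ThreeIndependent K n Γ A →
    (C C' : Connection Γ) →
    CompatibleWith K n Γ A C → CompatibleWith K n Γ A C' →
    SameConnection Γ C C'
mainTheorem2 K n Γ A indep C C' compat compat' {x} {y} {z} exy exz with z ≟ y
... | yes ≡.refl = ≡.trans (∇-back C exy) (≡.sym (∇-back C' exy))
... | no z≢y with ∇ C x y z ≟ ∇ C' x y z
...   | yes w≡w' = w≡w'
...   | no w≢w' = ⊥-elim (coplanar₂⇒¬linIndep3 plane (α-antisym exy)
          (compat (edge-sym exz) exy ≡.refl) (compat' (edge-sym exz) exy ≡.refl)
          (indep eyx eyw eyw' (∇-avoids-back C exy exz z≢y) x≢w' w≢w'))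
  where
  open Graph Γ
  open EdgeLabel A
  open PlaneLemmas K n
  open ConnectionProperties Γ
  eyx : Edge y x
  eyx = edge-sym exy
  eyw : Edge y (∇ C x y z)
  eyw = ∇-star C exy exz
  eyw' : Edge y (∇ C' x y z)
  eyw' = ∇-star C' exy exz
  x≢w' : ¬ (x ≡ ∇ C' x y z)
  x≢w' = ∇-avoids-back C' exy exz z≢y
  -- ∇_(y,x)(w') is the third vertex of star(x), besides y and z, needed by 3-independence
  plane : LinIndep2 (α z x) (α x y)
  plane = linIndep2-negˡ (linIndep3⇒linIndep2 (indep exz exy (∇-star C eyx eyw') z≢y
            (λ z≡z″ → w≢w' (∇-injective C eyx eyw eyw' (≡.trans (∇-inv C exy exz) z≡z″)))
            (λ y≡z″ → x≢w' (∇-injective C eyx eyx eyw' (≡.trans (∇-back C eyx) y≡z″)))))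
          (α-antisym exz)
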